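{- There is no finite set of points $Z=A_1+\dots+A_{d+1}\subseteq\mathbb{R}^d$, with $A_1,\dots,A_{d+1}\subseteq\mathbb{R}^d$ and $|A_i|=2$ for all $i$, that is in convex position.
   Context: $A_1+\dots+A_{d+1}$ denotes the Minkowski sum $\{x_1+\dots+x_{d+1}:x_i\in A_i\}$. A set of points is in convex position if no point of it is a convex combination of the other points of the set. -}

module Defs where

open import Data.Nat using (ℕ; zero; suc)
open import Data.Fin using (Fin; zero; suc)
open import Data.Bool using (Bool; true; false)
open import Data.Product using (Σ; _×_; _,_; ∃)
open import Data.Sum using (_⊎_)
open import Relation.Binary.PropositionalEquality using (_≡_; _≢_)
open import Relation.Nullary using (¬_)

-- The real numbers, axiomatised as a complete ordered field
-- (unique up to isomorphism, so quantifying over all such structures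
-- is the same as speaking about ℝ).
record RealField : Set₁ where
  infixl 6 _+_
  infixl 7 _*_
  infix  4 _≤_
  field
    Carrier : Set
    _+_ _*_ : Carrier → Carrier → Carrier
    -_      : Carrier → Carrier
    0# 1#   : Carrier
    _≤_     : Carrier → Carrier → Set
    +-assoc    : ∀ x y z → (x + y) + z ≡ x + (y + z)
    +-comm     : ∀ x y → x + y ≡ y + x
    +-identity : ∀ x → 0# + x ≡ x
    +-inverse  : ∀ x → (- x) + x ≡ 0#
    *-assoc    : ∀ x y z → (x * y) * z ≡ x * (y * z)
    *-comm     : ∀ x y → x * y ≡ y * x
    *-identity : ∀ x → 1# * x ≡ x
    distrib    : ∀ x y z → x * (y + z) ≡ (x * y) + (x * z)
    0≢1        : 0# ≢ 1#
    *-inverse  : ∀ x → x ≢ 0# → Σ Carrier (λ y → y * x ≡ 1#)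
    ≤-refl     : ∀ x → x ≤ x
    ≤-antisym  : ∀ {x y} → x ≤ y → y ≤ x → x ≡ y
    ≤-trans    : ∀ {x y z} → x ≤ y → y ≤ z → x ≤ z
    ≤-total    : ∀ x y → x ≤ y ⊎ y ≤ x
    +-mono-≤   : ∀ {x y} z → x ≤ y → x + z ≤ y + z
    *-nonneg   : ∀ {x y} → 0# ≤ x → 0# ≤ y → 0# ≤ x * y
    lub : (P : Carrier → Set) → Σ Carrier P →
          Σ Carrier (λ b → ∀ x → P x → x ≤ b) →
          Σ Carrier (λ s → (∀ x → P x → x ≤ s) ×
                           (∀ b → (∀ x → P x → x ≤ b) → s ≤ b))

module _ (R : RealField) where
  open RealField R

  Point : ℕ → Set
  Point d = Fin d → Carrier

  sumFin : ∀ {A : Set} n → (A → A → A) → A → (Fin n → A) → A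
  sumFin zero    _⊕_ e f = e
  sumFin (suc n) _⊕_ e f = f zero ⊕ sumFin n _⊕_ e (λ i → f (suc i))

  Σℝ : ∀ n → (Fin n → Carrier) → Carrier
  Σℝ n = sumFin n _+_ 0#

  _⊕ᵖ_ : ∀ {d} → Point d → Point d → Point d
  (p ⊕ᵖ q) j = p j + q j

  -- pointwise equality of points (avoids relying on function extensionality)
  _≈ᵖ_ : ∀ {d} → Point d → Point d → Set
  p ≈ᵖ q = ∀ j → p j ≡ q j

  0ᵖ : ∀ {d} → Point d
  0ᵖ j = 0#

  _·ᵖ_ : ∀ {d} → Carrier → Point d → Point d
  (c ·ᵖ p) j = c * p j

  -- A finite point set given by an indexing  pt : Fin n → Point d
  -- (the set is the image of pt; repetitions are allowed and collapse).
  -- z is a convex combination of points of the image of pt other than z.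
  ConvComboOfOthers : ∀ {d n} → (Fin n → Point d) → Point d → Set
  ConvComboOfOthers {d} {n} pt z =
    Σ (Fin n → Carrier) λ λs →
      (∀ k → 0# ≤ λs k) ×
      (∀ k → pt k ≈ᵖ z → λs k ≡ 0#) ×
      (Σℝ n λs ≡ 1#) ×
      (sumFin n _⊕ᵖ_ 0ᵖ (λ k → λs k ·ᵖ pt k) ≈ᵖ z)

  InConvexPosition : ∀ {d n} → (Fin n → Point d) → Set
  InConvexPosition pt = ∀ k → ¬ ConvComboOfOthers pt (pt k)

  pow2 : ℕ → ℕ
  pow2 zero    = 1
  pow2 (suc m) = pow2 m Data.Nat.+ pow2 m

  decode : ∀ m → Fin (pow2 m) → Fin m → Bool
  decode (suc m) i zero    with Data.Fin.splitAt (pow2 m) i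
  ... | Data.Sum.inj₁ _ = false
  ... | Data.Sum.inj₂ _ = true
  decode (suc m) i (suc j) with Data.Fin.splitAt (pow2 m) i
  ... | Data.Sum.inj₁ i' = decode m i' j
  ... | Data.Sum.inj₂ i' = decode m i' j

  -- Minkowski sum A_1 + ... + A_m of two-element sets A_i = {a i false, a i true},
  -- indexed by all choices.
  minkowski2 : ∀ {d} m → (Fin m → Bool → Point d) → Fin (pow2 m) → Point d
  minkowski2 m a i = sumFin m _⊕ᵖ_ 0ᵖ (λ j → a j (decode m i j))

{-# OPTIONS --safe #-}
-- The d + 1 edge vectors a_i(true) − a_i(false) are linearly dependent in ℝ^d,
-- say Σ c_i (a_i(true) − a_i(false)) = 0 with some c_i ≠ 0. Orient the i-th edge so that
-- its coefficient w_i = |c_i| is nonnegative, and let z be the point of the Minkowski sum that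
-- takes the tail of every oriented edge. Its neighbours z + D_i, obtained by switching the
-- i-th summand, satisfy Σ w_i D_i = 0, so z is their barycentre with weights w_i / Σ w_i,
-- and z ≠ z + D_i because the two points of A_i differ.
module Submission where

open import Defs
open import Data.Nat using (ℕ; suc)
open import Data.Fin using (Fin)
open import Data.Bool using (Bool; true; false)
open import Relation.Nullary using (¬_)

open import Algebra.Bundles using (CommutativeRing)
open import Algebra.Consequences.Propositional using (comm∧idˡ⇒id; comm∧invˡ⇒inv; comm∧distrˡ⇒distrʳ)
open import Data.Bool using (not; if_then_else_)
open import Data.Fin using (zero; suc; punchIn; _≟_; _↑ˡ_; _↑ʳ_)
open import Data.Fin.Properties using (punchInᵢ≢i; splitAt-↑ˡ; splitAt-↑ʳ; all?; ¬∀⟶∃¬; sequence)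
open import Data.Maybe using (nothing)
open import Data.Nat using (zero; s≤s)
import Data.Nat as ℕ
import Data.Nat.Properties as ℕ
open import Data.Product using (Σ-syntax; ∃-syntax; _×_; _,_; proj₁; proj₂)
open import Data.Sum using (inj₁; inj₂)
open import Data.Vec.Functional using (tail; removeAt; insertAt; updateAt)
open import Data.Vec.Functional.Properties
  using (insertAt-lookup; insertAt-punchIn; updateAt-updates; updateAt-minimal)
open import Effect.Monad using (RawMonad)
open import Function using (_∘_; case_of_)
open import Level using (0ℓ)
open import Relation.Binary.PropositionalEquality
open import Relation.Nullary using (Dec; yes; no; does)
open import Relation.Nullary.Decidable using (dec-true; dec-false; ¬¬-excluded-middle)
open import Relation.Nullary.Negation using (¬¬-Monad; contradiction)
open import Tactic.RingSolver.Core.AlmostCommutativeRing using (fromCommutativeRing)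

module _ (R : RealField) where
  open RealField R

  commutativeRing : CommutativeRing 0ℓ 0ℓ
  commutativeRing = record
    { Carrier = Carrier ; _≈_ = _≡_ ; _+_ = _+_ ; _*_ = _*_ ; -_ = -_ ; 0# = 0# ; 1# = 1#
    ; isCommutativeRing = record
      { isRing = record
        { +-isAbelianGroup = record
          { isGroup = record
            { isMonoid = record
              { isSemigroup = record
                { isMagma = record { isEquivalence = isEquivalence ; ∙-cong = cong₂ _+_ }
                ; assoc = +-assoc }
              ; identity = comm∧idˡ⇒id +-comm +-identity }
            ; inverse = comm∧invˡ⇒inv +-comm +-inverse
            ; ⁻¹-cong = cong -_ }
          ; comm = +-comm }
        ; *-cong = cong₂ _*_
        ; *-assoc = *-assoc
        ; *-identity = comm∧idˡ⇒id *-comm *-identity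
        ; distrib = distrib , comm∧distrˡ⇒distrʳ *-comm distrib }
      ; *-comm = *-comm } }

  open CommutativeRing commutativeRing
    using (ring; semiring; *-commutativeSemigroup; _-_; zeroˡ; zeroʳ; +-identityʳ; -‿inverseʳ)
  open import Algebra.Properties.Ring ring
    using ( xyx⁻¹≈y; -1*x≈-x; -‿distribˡ-*; -‿distribʳ-*; -‿involutive; -‿injective; -0#≈0#
          ; ⁻¹-anti-homo‿-; x∙y⁻¹≈ε⇒x≈y; +-identityʳ-unique)
  open import Algebra.Properties.Semiring.Sum semiring
    using ( sum; sum-cong-≗; sum-replicate-zero; sum-remove; ∑-comm; ∑-distrib-+
          ; *-distribˡ-sum; *-distribʳ-sum)
  open import Algebra.Properties.CommutativeSemigroup *-commutativeSemigroup using (x∙yz≈yx∙z)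
  open RawMonad (¬¬-Monad {0ℓ}) using (_>>=_; _<$>_; rawApplicative)
  open import Tactic.RingSolver.NonReflective (fromCommutativeRing commutativeRing (λ _ → nothing))

  *-cancelˡ-nonzero : ∀ {x y} → x ≢ 0# → x * y ≡ 0# → y ≡ 0#
  *-cancelˡ-nonzero {x} {y} x≢0 xy≡0 with *-inverse x x≢0
  ... | x⁻¹ , x⁻¹x≡1 = begin
    y               ≡⟨ sym (*-identity y) ⟩
    1# * y          ≡⟨ cong (_* y) (sym x⁻¹x≡1) ⟩
    (x⁻¹ * x) * y   ≡⟨ *-assoc x⁻¹ x y ⟩
    x⁻¹ * (x * y)   ≡⟨ cong (x⁻¹ *_) xy≡0 ⟩
    x⁻¹ * 0#        ≡⟨ zeroʳ x⁻¹ ⟩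
    0#              ∎
    where open ≡-Reasoning

  *-nonzero : ∀ {x y} → x ≢ 0# → y ≢ 0# → x * y ≢ 0#
  *-nonzero x≢0 y≢0 xy≡0 = y≢0 (*-cancelˡ-nonzero x≢0 xy≡0)

  ≤-respʳ-≡ : ∀ {x y z} → y ≡ z → x ≤ y → x ≤ z
  ≤-respʳ-≡ refl x≤y = x≤y

  ≤-respˡ-≡ : ∀ {x y z} → x ≡ y → x ≤ z → y ≤ z
  ≤-respˡ-≡ refl x≤z = x≤z

  x≤x+y : ∀ {x y} → 0# ≤ y → x ≤ x + y
  x≤x+y {x} {y} 0≤y = ≤-respˡ-≡ (+-identity x) (≤-respʳ-≡ (+-comm y x) (+-mono-≤ x 0≤y))

  +-nonneg : ∀ {x y} → 0# ≤ x → 0# ≤ y → 0# ≤ x + y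
  +-nonneg 0≤x 0≤y = ≤-trans 0≤x (x≤x+y 0≤y)

  neg-nonneg : ∀ {x} → x ≤ 0# → 0# ≤ - x
  neg-nonneg {x} x≤0 = ≤-respˡ-≡ (-‿inverseʳ x) (≤-respʳ-≡ (+-identity (- x)) (+-mono-≤ (- x) x≤0))

  0≤1 : 0# ≤ 1#
  0≤1 with ≤-total 0# 1#
  ... | inj₁ 0≤1 = 0≤1
  ... | inj₂ 1≤0 = ≤-respʳ-≡ (trans (-1*x≈-x (- 1#)) (-‿involutive 1#))
                              (*-nonneg (neg-nonneg 1≤0) (neg-nonneg 1≤0))

  ¬0≤-1 : ¬ 0# ≤ - 1#
  ¬0≤-1 0≤-1 = 0≢1 (≤-antisym 0≤1 1≤0)
    where
    1≤0 : 1# ≤ 0#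
    1≤0 = ≤-respˡ-≡ (+-identity 1#) (≤-respʳ-≡ (+-inverse 1#) (+-mono-≤ 1# 0≤-1))

  inverse-nonneg : ∀ {x y} → y * x ≡ 1# → 0# ≤ x → 0# ≤ y
  inverse-nonneg {x} {y} yx≡1 0≤x with ≤-total 0# y
  ... | inj₁ 0≤y = 0≤y
  ... | inj₂ y≤0 = contradiction (≤-respʳ-≡ -yx≡-1 (*-nonneg (neg-nonneg y≤0) 0≤x)) ¬0≤-1
    where
    -yx≡-1 : (- y) * x ≡ - 1#
    -yx≡-1 = trans (sym (-‿distribˡ-* y x)) (cong -_ yx≡1)

  Σℝ≡sum : ∀ n (f : Fin n → Carrier) → Σℝ R n f ≡ sum f
  Σℝ≡sum zero    f = refl
  Σℝ≡sum (suc n) f = cong (f zero +_) (Σℝ≡sum n (tail f))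

  sumᵖ-coordinate : ∀ {d} n (p : Fin n → Point R d) j →
                    sumFin R n (_⊕ᵖ_ R) (0ᵖ R) p j ≡ sum (λ k → p k j)
  sumᵖ-coordinate zero    p j = refl
  sumᵖ-coordinate (suc n) p j = cong (p zero j +_) (sumᵖ-coordinate n (tail p) j)

  sum-nonneg : ∀ {n} (f : Fin n → Carrier) → (∀ i → 0# ≤ f i) → 0# ≤ sum f
  sum-nonneg {zero}  f 0≤f = ≤-refl 0#
  sum-nonneg {suc n} f 0≤f = +-nonneg (0≤f zero) (sum-nonneg (tail f) (0≤f ∘ suc))

  term≤sum : ∀ {n} (f : Fin (suc n) → Carrier) → (∀ i → 0# ≤ f i) → ∀ i → f i ≤ sum f
  term≤sum f 0≤f i = ≤-respʳ-≡ (sym (sum-remove f)) (x≤x+y (sum-nonneg (removeAt f i) (0≤f ∘ punchIn i)))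

  sum-differsAt : ∀ {n} (i : Fin n) (f g : Fin n → Carrier) → (∀ k → k ≢ i → g k ≡ f k) →
                  sum g ≡ sum f + (g i - f i)
  sum-differsAt {suc n} i f g g≡f = begin
    sum g                                     ≡⟨ sum-remove g ⟩
    g i + sum (removeAt g i)                  ≡⟨ cong (g i +_) (sum-cong-≗ g≡f-offᵢ) ⟩
    g i + S                                   ≡⟨ sym (xyx⁻¹≈y (f i) (g i + S)) ⟩
    f i + (g i + S) - f i                     ≡⟨ +-rearrange (f i) (g i) S (- f i) ⟩
    (f i + S) + (g i - f i)                   ≡⟨ cong (_+ (g i - f i)) (sym (sum-remove f)) ⟩
    sum f + (g i - f i)                       ∎
    where
    open ≡-Reasoning
    S : Carrier
    S = sum (removeAt f i)
    g≡f-offᵢ : ∀ l → g (punchIn i l) ≡ f (punchIn i l)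
    g≡f-offᵢ l = g≡f (punchIn i l) (punchInᵢ≢i i l)
    +-rearrange : ∀ a b c d → (a + (b + c)) + d ≡ (a + c) + (b + d)
    +-rearrange = solve 4 (λ a b c d → ((a ⊕ (b ⊕ c)) ⊕ d) ⊜ ((a ⊕ c) ⊕ (b ⊕ d))) refl

  indicator : ∀ {P : Set} → Dec P → Carrier
  indicator P? = if does P? then 1# else 0#

  indicator-nonneg : ∀ {P : Set} (P? : Dec P) → 0# ≤ indicator P?
  indicator-nonneg (yes _) = 0≤1
  indicator-nonneg (no _)  = ≤-refl 0#

  sum-indicator : ∀ {n} (e : Fin n) (f : Fin n → Carrier) →
                  sum (λ k → indicator (k ≟ e) * f k) ≡ f e
  sum-indicator {suc n} e f = begin
    sum (λ k → indicator (k ≟ e) * f k)   ≡⟨ sum-remove {i = e} (λ k → indicator (k ≟ e) * f k) ⟩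
    indicator (e ≟ e) * f e + sum (λ l → indicator (punchIn e l ≟ e) * f (punchIn e l))
      ≡⟨ cong₂ _+_ (cong (λ b → (if b then 1# else 0#) * f e) (dec-true (e ≟ e) refl))
                   (sum-cong-≗ λ l → cong (λ b → (if b then 1# else 0#) * f (punchIn e l))
                                          (dec-false (punchIn e l ≟ e) (punchInᵢ≢i e l))) ⟩
    1# * f e + sum (λ l → 0# * f (punchIn e l))
      ≡⟨ cong₂ _+_ (*-identity (f e))
                   (trans (sum-cong-≗ (λ l → zeroˡ (f (punchIn e l)))) (sum-replicate-zero n)) ⟩
    f e + 0#                              ≡⟨ +-identityʳ (f e) ⟩
    f e                                   ∎
    where open ≡-Reasoning

  combination : ∀ {n m} → (Fin n → Carrier) → (Fin n → Fin m → Carrier) → Fin m → Carrier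
  combination c v j = sum (λ i → c i * v i j)

  LinearlyDependent : ∀ {n m} → (Fin n → Fin m → Carrier) → Set
  LinearlyDependent {n} v = Σ[ c ∈ (Fin n → Carrier) ] (∀ j → combination c v j ≡ 0#) × ∃[ i ] c i ≢ 0#

  dependentTails⇒dependent : ∀ {n m} (v : Fin n → Fin (suc m) → Carrier) → (∀ i → v i zero ≡ 0#) →
                       LinearlyDependent (tail ∘ v) → LinearlyDependent v
  dependentTails⇒dependent {n} v v₀≡0 (c , c·tail≡0 , nonzero) = c , c·v≡0 , nonzero
    where
    c·v≡0 : ∀ j → combination c v j ≡ 0#
    c·v≡0 zero    = trans (sum-cong-≗ (λ i → trans (cong (c i *_) (v₀≡0 i)) (zeroʳ (c i))))
                          (sum-replicate-zero n)
    c·v≡0 (suc j) = c·tail≡0 j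

  module _ {n m} (v : Fin (suc n) → Fin (suc m) → Carrier) (i : Fin (suc n)) where

    eliminate : Fin n → Fin (suc m) → Carrier
    eliminate l j = v i zero * v (punchIn i l) j + (- v (punchIn i l) zero) * v i j

    eliminate-zero : ∀ l → eliminate l zero ≡ 0#
    eliminate-zero l = begin
      p * y + (- y) * p     ≡⟨ cong₂ _+_ (*-comm p y) (sym (-‿distribˡ-* y p)) ⟩
      y * p + - (y * p)     ≡⟨ -‿inverseʳ (y * p) ⟩
      0#                    ∎
      where
      open ≡-Reasoning
      p = v i zero
      y = v (punchIn i l) zero

    liftCoefficients : (Fin n → Carrier) → Fin (suc n) → Carrier
    liftCoefficients c = insertAt (λ l → v i zero * c l) i (sum (λ l → c l * - v (punchIn i l) zero))

    combination-liftCoefficients : ∀ c j →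
                                   combination (liftCoefficients c) v j ≡ combination c eliminate j
    combination-liftCoefficients c j = begin
      combination (liftCoefficients c) v j
        ≡⟨ sum-remove {i = i} (λ k → liftCoefficients c k * v k j) ⟩
      liftCoefficients c i * w + sum (λ l → liftCoefficients c (punchIn i l) * x l)
        ≡⟨ cong₂ _+_ (cong (_* w) (insertAt-lookup _ i _))
                     (sum-cong-≗ (λ l → cong (_* x l) (insertAt-punchIn _ i _ l))) ⟩
      t * w + sum (λ l → (p * c l) * x l)
        ≡⟨ +-comm (t * w) _ ⟩
      sum (λ l → (p * c l) * x l) + t * w
        ≡⟨ cong (sum (λ l → (p * c l) * x l) +_) (*-distribʳ-sum w (λ l → c l * - y l)) ⟩
      sum (λ l → (p * c l) * x l) + sum (λ l → (c l * - y l) * w)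
        ≡⟨ sym (∑-distrib-+ (λ l → (p * c l) * x l) (λ l → (c l * - y l) * w)) ⟩
      sum (λ l → (p * c l) * x l + (c l * - y l) * w)
        ≡⟨ sum-cong-≗ (λ l → sym (trans (distrib (c l) _ _)
                              (cong₂ _+_ (x∙yz≈yx∙z (c l) p (x l)) (sym (*-assoc (c l) (- y l) w))))) ⟩
      combination c eliminate j ∎
      where
      open ≡-Reasoning
      p = v i zero
      w = v i j
      x = λ l → v (punchIn i l) j
      y = λ l → v (punchIn i l) zero
      t = sum (λ l → c l * - y l)

    dependentEliminated⇒dependent : v i zero ≢ 0# → LinearlyDependent eliminate → LinearlyDependent v
    dependentEliminated⇒dependent p≢0 (c , c·e≡0 , l , cₗ≢0) =
      liftCoefficients c ,
      (λ j → trans (combination-liftCoefficients c j) (c·e≡0 j)) ,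
      punchIn i l ,
      subst (_≢ 0#) (sym (insertAt-punchIn _ i _ l)) (*-nonzero p≢0 cₗ≢0)

  -- Only doubly negated: the elimination has to decide whether a pivot vanishes, and equality
  -- in an abstract ordered field is not decidable.
  ¬¬-linearlyDependent : ∀ {m n} → m ℕ.≤ n → (v : Fin (suc n) → Fin m → Carrier) →
                         ¬ ¬ LinearlyDependent v
  ¬¬-linearlyDependent {zero} _ v = contradiction ((λ _ → 1#) , (λ ()) , zero , 0≢1 ∘ sym)
  ¬¬-linearlyDependent {suc m} {suc n} (s≤s m≤n) v =
    sequence rawApplicative (λ i → ¬¬-excluded-middle) >>= λ v₀≡0? → case all? v₀≡0? of λ where
      (yes v₀≡0) →
        dependentTails⇒dependent v v₀≡0
          <$> ¬¬-linearlyDependent (ℕ.m≤n⇒m≤1+n m≤n) (tail ∘ v)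
      (no ¬v₀≡0) → let i , vᵢ₀≢0 = ¬∀⟶∃¬ _ _ v₀≡0? ¬v₀≡0 in
        dependentEliminated⇒dependent v i vᵢ₀≢0 ∘ dependentTails⇒dependent (eliminate v i) (eliminate-zero v i)
          <$> ¬¬-linearlyDependent m≤n (tail ∘ eliminate v i)

  prepend : ∀ m → Bool → Fin (pow2 R m) → Fin (pow2 R (suc m))
  prepend m false x = x ↑ˡ pow2 R m
  prepend m true  x = pow2 R m ↑ʳ x

  encode : ∀ m → (Fin m → Bool) → Fin (pow2 R m)
  encode zero    f = zero
  encode (suc m) f = prepend m (f zero) (encode m (tail f))

  decode-prepend-zero : ∀ m b x → decode R (suc m) (prepend m b x) zero ≡ b
  decode-prepend-zero m false x rewrite splitAt-↑ˡ (pow2 R m) x (pow2 R m) = refl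
  decode-prepend-zero m true  x rewrite splitAt-↑ʳ (pow2 R m) (pow2 R m) x = refl

  decode-prepend-suc : ∀ m b x j → decode R (suc m) (prepend m b x) (suc j) ≡ decode R m x j
  decode-prepend-suc m false x j rewrite splitAt-↑ˡ (pow2 R m) x (pow2 R m) = refl
  decode-prepend-suc m true  x j rewrite splitAt-↑ʳ (pow2 R m) (pow2 R m) x = refl

  decode-encode : ∀ m f j → decode R m (encode m f) j ≡ f j
  decode-encode (suc m) f zero    = decode-prepend-zero m (f zero) _
  decode-encode (suc m) f (suc j) =
    trans (decode-prepend-suc m (f zero) _ j) (decode-encode m (tail f) j)

  minkowski2-encode : ∀ {d} m (a : Fin m → Bool → Point R d) f j →
                      minkowski2 R m a (encode m f) j ≡ sum (λ l → a l (f l) j)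
  minkowski2-encode m a f j = trans (sumᵖ-coordinate m _ j)
    (sum-cong-≗ (λ l → cong (λ b → a l b j) (decode-encode m f l)))

  edge : (Bool → Carrier) → Bool → Carrier
  edge t b = t (not b) - t b

  minkowski2-flip : ∀ {d m} (a : Fin m → Bool → Point R d) (ε : Fin m → Bool) i j →
                    minkowski2 R m a (encode m (updateAt ε i not)) j ≡
                    minkowski2 R m a (encode m ε) j + edge (λ b → a i b j) (ε i)
  minkowski2-flip {m = m} a ε i j = begin
    minkowski2 R m a (encode m (updateAt ε i not)) j
      ≡⟨ minkowski2-encode m a (updateAt ε i not) j ⟩
    sum (λ l → a l (updateAt ε i not l) j)
      ≡⟨ sum-differsAt i (λ l → a l (ε l) j) (λ l → a l (updateAt ε i not l) j)
           (λ l l≢i → cong (λ b → a l b j) (updateAt-minimal l i ε l≢i)) ⟩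
    sum (λ l → a l (ε l) j) + (a i (updateAt ε i not i) j - a i (ε i) j)
      ≡⟨ cong₂ _+_ (sym (minkowski2-encode m a ε j))
                   (cong (λ b → a i b j - a i (ε i) j) (updateAt-updates i ε)) ⟩
    minkowski2 R m a (encode m ε) j + edge (λ b → a i b j) (ε i) ∎
    where open ≡-Reasoning

  IsConvexCombination : ∀ {d m} → (Fin m → Carrier) → (Fin m → Point R d) → Point R d → Set
  IsConvexCombination μ p z = (∀ i → 0# ≤ μ i) × sum μ ≡ 1# × (∀ j → sum (λ i → μ i * p i j) ≡ z j)

  sum-nonneg-nonzero : ∀ {n} (w : Fin n → Carrier) → (∀ i → 0# ≤ w i) → ∃[ i ] w i ≢ 0# →
                       sum w ≢ 0#
  sum-nonneg-nonzero {suc n} w 0≤w (i , wᵢ≢0) Σw≡0 =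
    wᵢ≢0 (≤-antisym (≤-respʳ-≡ Σw≡0 (term≤sum w 0≤w i)) (0≤w i))

  balanced⇒convexCombination : ∀ {d m} (w : Fin m → Carrier) (p : Fin m → Point R d) (z : Point R d)
    (D : Fin m → Point R d) → (∀ i → 0# ≤ w i) → ∃[ i ] w i ≢ 0# →
    (∀ i j → p i j ≡ z j + D i j) → (∀ j → sum (λ i → w i * D i j) ≡ 0#) →
    ∃[ μ ] IsConvexCombination μ p z
  balanced⇒convexCombination w p z D 0≤w w≢0 p≡z+D balanced =
    μ , (λ i → *-nonneg 0≤y (0≤w i)) , trans (sym (*-distribˡ-sum y w)) yΣw≡1 , μp≡z
    where
    inverse : Σ[ y ∈ Carrier ] y * sum w ≡ 1#
    inverse = *-inverse (sum w) (sum-nonneg-nonzero w 0≤w w≢0)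
    y : Carrier
    y = proj₁ inverse
    yΣw≡1 : y * sum w ≡ 1#
    yΣw≡1 = proj₂ inverse
    0≤y : 0# ≤ y
    0≤y = inverse-nonneg yΣw≡1 (sum-nonneg w 0≤w)
    μ : Fin _ → Carrier
    μ i = y * w i
    μp≡z : ∀ j → sum (λ i → μ i * p i j) ≡ z j
    μp≡z j = begin
      sum (λ i → μ i * p i j)
        ≡⟨ sum-cong-≗ (λ i → trans (cong (μ i *_) (p≡z+D i j))
                            (trans (distrib (μ i) _ _) (cong (μ i * z j +_) (*-assoc y (w i) _)))) ⟩
      sum (λ i → μ i * z j + y * (w i * D i j))
        ≡⟨ ∑-distrib-+ (λ i → μ i * z j) (λ i → y * (w i * D i j)) ⟩
      sum (λ i → μ i * z j) + sum (λ i → y * (w i * D i j))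
        ≡⟨ sym (cong₂ _+_ (*-distribʳ-sum (z j) μ) (*-distribˡ-sum y (λ i → w i * D i j))) ⟩
      sum μ * z j + y * sum (λ i → w i * D i j)
        ≡⟨ cong₂ (λ s t → s * z j + y * t) (sym (*-distribˡ-sum y w)) (balanced j) ⟩
      (y * sum w) * z j + y * 0#
        ≡⟨ cong₂ (λ s t → s * z j + t) yΣw≡1 (zeroʳ y) ⟩
      1# * z j + 0#
        ≡⟨ trans (+-identityʳ _) (*-identity (z j)) ⟩
      z j ∎
      where open ≡-Reasoning

  convexCombination⇒convComboOfOthers : ∀ {d m P} (pt : Fin P → Point R d) (e : Fin m → Fin P)
    (z : Point R d) → ∃[ μ ] IsConvexCombination μ (pt ∘ e) z →
    (∀ i → ¬ _≈ᵖ_ R (pt (e i)) z) → ConvComboOfOthers R pt z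
  convexCombination⇒convComboOfOthers {d} {m} {P} pt e z (μ , 0≤μ , Σμ≡1 , μpt≡z) pt∘e≉z =
    λs , 0≤λs , λs-vanishesAt-z , trans (Σℝ≡sum P λs) Σλs≡1 , λs·pt≡z
    where
    λs : Fin P → Carrier
    λs k = sum (λ i → indicator (k ≟ e i) * μ i)

    0≤λs : ∀ k → 0# ≤ λs k
    0≤λs k = sum-nonneg _ (λ i → *-nonneg (indicator-nonneg (k ≟ e i)) (0≤μ i))

    λs-vanishesAt-z : ∀ k → _≈ᵖ_ R (pt k) z → λs k ≡ 0#
    λs-vanishesAt-z k ptₖ≈z = trans (sum-cong-≗ term≡0) (sum-replicate-zero m)
      where
      term≡0 : ∀ i → indicator (k ≟ e i) * μ i ≡ 0#
      term≡0 i with k ≟ e i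
      ... | yes refl = contradiction ptₖ≈z (pt∘e≉z i)
      ... | no _     = zeroˡ (μ i)

    Σλs≡1 : sum λs ≡ 1#
    Σλs≡1 = trans (∑-comm (λ k i → indicator (k ≟ e i) * μ i))
                  (trans (sum-cong-≗ (λ i → sum-indicator (e i) (λ _ → μ i))) Σμ≡1)

    λs·pt≡z : ∀ j → sumFin R P (_⊕ᵖ_ R) (0ᵖ R) (λ k → _·ᵖ_ R (λs k) (pt k)) j ≡ z j
    λs·pt≡z j = begin
      sumFin R P (_⊕ᵖ_ R) (0ᵖ R) (λ k → _·ᵖ_ R (λs k) (pt k)) j
        ≡⟨ sumᵖ-coordinate P _ j ⟩
      sum (λ k → λs k * pt k j)
        ≡⟨ sum-cong-≗ (λ k → trans (*-distribʳ-sum (pt k j) (λ i → indicator (k ≟ e i) * μ i))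
                                  (sum-cong-≗ (λ i → *-assoc (indicator (k ≟ e i)) (μ i) (pt k j)))) ⟩
      sum (λ k → sum (λ i → indicator (k ≟ e i) * (μ i * pt k j)))
        ≡⟨ ∑-comm (λ k i → indicator (k ≟ e i) * (μ i * pt k j)) ⟩
      sum (λ i → sum (λ k → indicator (k ≟ e i) * (μ i * pt k j)))
        ≡⟨ sum-cong-≗ (λ i → sum-indicator (e i) (λ k → μ i * pt k j)) ⟩
      sum (λ i → μ i * pt (e i) j)
        ≡⟨ μpt≡z j ⟩
      z j ∎
      where open ≡-Reasoning

  record Orientation (c : Carrier) : Set where
    field
      side           : Bool
      weight         : Carrier
      weight-nonneg  : 0# ≤ weight
      weight-nonzero : c ≢ 0# → weight ≢ 0#
      weight-edge    : ∀ t → weight * edge t side ≡ c * edge t false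

  orient : ∀ c → Orientation c
  orient c with ≤-total 0# c
  ... | inj₁ 0≤c = record { side = false ; weight = c ; weight-nonneg = 0≤c
                          ; weight-nonzero = λ c≢0 → c≢0 ; weight-edge = λ t → refl }
  ... | inj₂ c≤0 = record { side = true ; weight = - c ; weight-nonneg = neg-nonneg c≤0
                          ; weight-nonzero = λ c≢0 -c≡0 → c≢0 (-‿injective (trans -c≡0 (sym -0#≈0#)))
                          ; weight-edge = λ t → begin
                              (- c) * (t false - t true)   ≡⟨ sym (-‿distribˡ-* c _) ⟩
                              - (c * (t false - t true))   ≡⟨ -‿distribʳ-* c _ ⟩
                              c * - (t false - t true)     ≡⟨ cong (c *_) (⁻¹-anti-homo‿- (t false) (t true)) ⟩
                              c * (t true - t false)       ∎ }
    where open ≡-Reasoning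

  edge≢0 : ∀ {d} (t : Bool → Point R d) → ¬ _≈ᵖ_ R (t false) (t true) →
           ∀ b → ¬ (∀ j → edge (λ b → t b j) b ≡ 0#)
  edge≢0 t t₀≉t₁ false edge≡0 = t₀≉t₁ (λ j → sym (x∙y⁻¹≈ε⇒x≈y _ _ (edge≡0 j)))
  edge≢0 t t₀≉t₁ true  edge≡0 = t₀≉t₁ (λ j → x∙y⁻¹≈ε⇒x≈y _ _ (edge≡0 j))

  dependentEdges⇒¬convexPosition : ∀ {d m} (a : Fin m → Bool → Point R d) →
    (∀ i → ¬ _≈ᵖ_ R (a i false) (a i true)) → LinearlyDependent (λ i j → edge (λ b → a i b j) false) →
    ¬ InConvexPosition R (minkowski2 R m a)
  dependentEdges⇒¬convexPosition {d} {m} a distinct (c , Σc·edge≡0 , i₀ , cᵢ₀≢0) convex =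
    convex (encode m ε) (convexCombination⇒convComboOfOthers pt flipped z
      (balanced⇒convexCombination w (pt ∘ flipped) z D w-nonneg (i₀ , wᵢ₀≢0) (minkowski2-flip a ε) balanced)
      flipped≉z)
    where
    open Orientation
    ε : Fin m → Bool
    ε i = side (orient (c i))
    w : Fin m → Carrier
    w i = weight (orient (c i))
    w-nonneg : ∀ i → 0# ≤ w i
    w-nonneg i = weight-nonneg (orient (c i))
    wᵢ₀≢0 : w i₀ ≢ 0#
    wᵢ₀≢0 = weight-nonzero (orient (c i₀)) cᵢ₀≢0
    pt : Fin (pow2 R m) → Point R d
    pt = minkowski2 R m a
    z : Point R d
    z = pt (encode m ε)
    flipped : Fin m → Fin (pow2 R m)
    flipped i = encode m (updateAt ε i not)
    D : Fin m → Point R d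
    D i j = edge (λ b → a i b j) (ε i)

    balanced : ∀ j → sum (λ i → w i * D i j) ≡ 0#
    balanced j = trans (sum-cong-≗ (λ i → weight-edge (orient (c i)) (λ b → a i b j))) (Σc·edge≡0 j)

    flipped≉z : ∀ i → ¬ _≈ᵖ_ R (pt (flipped i)) z
    flipped≉z i flipped≈z = edge≢0 (a i) (distinct i) (ε i)
      (λ j → +-identityʳ-unique (z j) (D i j) (trans (sym (minkowski2-flip a ε i j)) (flipped≈z j)))

lemma6p1 : (R : RealField) (d : ℕ) (a : Fin (suc d) → Bool → Point R d) →
    (∀ i → ¬ _≈ᵖ_ R (a i false) (a i true)) →
    ¬ InConvexPosition R (minkowski2 R (suc d) a)
lemma6p1 R d a distinct convex =
  ¬¬-linearlyDependent R ℕ.≤-refl edges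
    (λ dependent → dependentEdges⇒¬convexPosition R a distinct dependent convex)
  where
  edges : Fin (suc d) → Point R d
  edges i j = edge R (λ b → a i b j) false
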